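{- A Kripke model $\mathcal{M}=(X,R,V)$ is image-compact if and only if it is m-saturated.
   Context: A Kripke model is $(X,R,V)$ with $R\subseteq X\times X$ and $V:\mathrm{Prop}\to\mathcal{P}(X)$. Classical modal formulae ($\mathsf{ML}$): $\phi::=\top\mid\bot\mid p\mid\phi\wedge\phi\mid\phi\vee\phi\mid\phi\to\phi\mid\Box\phi$, with $\neg\phi:=\phi\to\bot$, interpreted classically, with $x\Vdash\Box\phi$ iff all $y$ with $xRy$ satisfy $\phi$. Write $R[x]=\{y\mid xRy\}$. The model is image-compact if there is a collection $A\subseteq\mathcal{P}(X)$ containing $\emptyset$, $X$ and all $V(p)$, closed under finite unions, finite intersections, $(a,b)\mapsto(X\setminus a)\cup b$ and $a\mapsto\{x\mid R[x]\subseteq a\}$, such that $R[x]$ is compact for every $x$ in the topology generated by the subbase $A\cup\{X\setminus a\mid a\in A\}$. A set $\Sigma$ of formulae is satisfiable in $a\subseteq X$ if some $x\in a$ satisfies every formula of $\Sigma$, and finitely satisfiable in $a$ if every finite subset is satisfiable in $a$. The model is m-saturated if for every $x\in X$ and every $\Sigma\subseteq\mathsf{ML}$: if $\Sigma$ is finitely satisfiable in $R[x]$ then $\Sigma$ is satisfiable in $R[x]$. -}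

module Defs where

open import Level using (Level; 0ℓ) renaming (suc to lsuc)
open import Data.Bool using (Bool; true; false)
open import Data.Empty using (⊥)
open import Data.Unit using (⊤)
open import Data.Sum using (_⊎_)
open import Data.Product using (Σ; _×_; _,_; ∃)
open import Data.List using (List)
open import Data.List.Relation.Unary.All using (All)
open import Data.List.Relation.Unary.Any using (Any)
open import Relation.Nullary using (¬_)
open import Axiom.ExcludedMiddle public using (ExcludedMiddle)

data Fm (Prop : Set) : Set where
  ⊤′  : Fm Prop
  ⊥′  : Fm Prop
  var : Prop → Fm Prop
  _∧′_ : Fm Prop → Fm Prop → Fm Prop
  _∨′_ : Fm Prop → Fm Prop → Fm Prop
  _⇒′_ : Fm Prop → Fm Prop → Fm Prop
  □′  : Fm Prop → Fm Prop

Subset : Set → Set₁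
Subset X = X → Set

record Kripke (Prop : Set) : Set₁ where
  field
    X : Set
    R : X → X → Set
    V : Prop → Subset X

module _ {Prop : Set} (M : Kripke Prop) where
  open Kripke M

  image : X → Subset X
  image x y = R x y

  _⊩_ : X → Fm Prop → Set
  x ⊩ ⊤′ = ⊤
  x ⊩ ⊥′ = ⊥
  x ⊩ var p = V p x
  x ⊩ (φ ∧′ ψ) = (x ⊩ φ) × (x ⊩ ψ)
  x ⊩ (φ ∨′ ψ) = (x ⊩ φ) ⊎ (x ⊩ ψ)
  x ⊩ (φ ⇒′ ψ) = (x ⊩ φ) → (x ⊩ ψ)
  x ⊩ □′ φ = ∀ y → R x y → y ⊩ φ

  Satisfiable : (Fm Prop → Set) → Subset X → Set
  Satisfiable Γ a = Σ X λ y → a y × (∀ φ → Γ φ → y ⊩ φ)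

  FinitelySatisfiable : (Fm Prop → Set) → Subset X → Set
  FinitelySatisfiable Γ a =
    (fs : List (Fm Prop)) → All Γ fs → Σ X λ y → a y × All (λ φ → y ⊩ φ) fs

  MSaturated : Set₁
  MSaturated = ∀ x (Γ : Fm Prop → Set) →
    FinitelySatisfiable Γ (image x) → Satisfiable Γ (image x)

  record IsAdmissible (A : Subset X → Set) : Set₁ where
    field
      has-∅   : A (λ _ → ⊥)
      has-X   : A (λ _ → ⊤)
      has-V   : ∀ p → A (V p)
      has-∪   : ∀ a b → A a → A b → A (λ x → a x ⊎ b x)
      has-∩   : ∀ a b → A a → A b → A (λ x → a x × b x)
      has-⇒   : ∀ a b → A a → A b → A (λ x → ¬ a x ⊎ b x)
      has-□   : ∀ a → A a → A (λ x → ∀ y → R x y → a y)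

  -- Subbasic sets: a ∈ A (tag true) or X \ a with a ∈ A (tag false).
  SubbaseElt : (Subset X → Set) → Set₁
  SubbaseElt A = Σ (Subset X) λ a → A a × Bool

  ⟦_⟧ₛ : {A : Subset X → Set} → SubbaseElt A → Subset X
  ⟦ (a , _ , true) ⟧ₛ x = a x
  ⟦ (a , _ , false) ⟧ₛ x = ¬ a x

  -- Open sets of the topology generated by the subbase A ∪ {X \ a | a ∈ A}:
  -- every point of O lies in a finite intersection of subbasic sets inside O.
  IsOpen : (Subset X → Set) → Subset X → Set₁
  IsOpen A O = ∀ x → O x →
    Σ (List (SubbaseElt A)) λ ss →
      All (λ s → ⟦ s ⟧ₛ x) ss × (∀ z → All (λ s → ⟦ s ⟧ₛ z) ss → O z)

  IsCompact : (Subset X → Set) → Subset X → Set₂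
  IsCompact A K = (I : Set₁) (U : I → Subset X) → (∀ i → IsOpen A (U i)) →
    (∀ y → K y → Σ I λ i → U i y) →
    Σ (List I) λ is → ∀ y → K y → Any (λ i → U i y) is

  ImageCompact : Set₂
  ImageCompact = Σ (Subset X → Set) λ A →
    IsAdmissible A × (∀ x → IsCompact A (image x))

{-# OPTIONS --safe #-}
-- Every admissible collection contains, up to extension, the truth set ⟦ φ ⟧ of each
-- formula, so complements of truth sets are open: a finitely satisfiable but unsatisfiable
-- Σ would give an open cover of R[x] by the sets ∁ ⟦ φ ⟧ (φ ∈ Σ) with no finite subcover.
-- Conversely, take the definable sets as the collection; then every basic open set is a
-- truth set. If an open cover of R[x] had no finite subcover, the formulas whose refutation
-- sets lie inside one member of the cover would be finitely satisfiable in R[x], hence by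
-- saturation true at some y; but y has a basic neighbourhood ⟦ φ ⟧ inside a member of the
-- cover, so y satisfies both φ and ¬ φ.
module Submission where

open import Defs
open import Level using (_⊔_; Lift; lift; lower; 0ℓ) renaming (suc to lsuc)
open import Function using (_∘_)
open import Function.Bundles using (_⇔_; mk⇔)
open import Data.Bool using (true; false)
open import Data.Empty using (⊥)
open import Data.Unit using (tt)
open import Data.Sum using (inj₁; inj₂)
open import Data.Product using (Σ; _×_; _,_; proj₁; proj₂)
open import Data.List using (List; []; _∷_; map; foldr)
open import Data.List.Relation.Unary.All as All using (All; []; _∷_)
open import Data.List.Relation.Unary.All.Properties as All using (Any¬⇒¬All; ¬All⇒Any¬)
open import Data.List.Relation.Unary.Any using (Any; here; there)
import Data.List.Relation.Unary.Any.Properties as Any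
open import Relation.Nullary using (¬_; yes; no; contradiction)
open import Relation.Nullary.Decidable using (True; toWitness; fromWitness; map′; decidable-stable)
open import Relation.Unary using (Decidable; _⊆_; _≐_; ∁; _∩_; _∪_)

lowerEM : ∀ {a} ℓ → ExcludedMiddle (a ⊔ ℓ) → ExcludedMiddle a
lowerEM ℓ em {P} = map′ lower lift (em {Lift ℓ P})

module _ {Prop : Set} (M : Kripke Prop) where
  open Kripke M

  _⊨_ : X → Fm Prop → Set
  x ⊨ φ = _⊩_ M x φ

  ⟦_⟧ : Fm Prop → Subset X
  ⟦ φ ⟧ x = x ⊨ φ

  Definable : Subset X → Set
  Definable a = Σ (Fm Prop) λ φ → a ≐ ⟦ φ ⟧

  module _ {a b : Subset X} (φ ψ : Fm Prop) (a≐φ : a ≐ ⟦ φ ⟧) (b≐ψ : b ≐ ⟦ ψ ⟧) where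

    ∩-≐-∧ : a ∩ b ≐ ⟦ φ ∧′ ψ ⟧
    ∩-≐-∧ = (λ (p , q) → proj₁ a≐φ p , proj₁ b≐ψ q)
          , (λ (p , q) → proj₂ a≐φ p , proj₂ b≐ψ q)

    ∪-≐-∨ : a ∪ b ≐ ⟦ φ ∨′ ψ ⟧
    ∪-≐-∨ = (λ { (inj₁ p) → inj₁ (proj₁ a≐φ p) ; (inj₂ q) → inj₂ (proj₁ b≐ψ q) })
          , (λ { (inj₁ p) → inj₁ (proj₂ a≐φ p) ; (inj₂ q) → inj₂ (proj₂ b≐ψ q) })

    ∁∪-≐-⇒ : Decidable a → ∁ a ∪ b ≐ ⟦ φ ⇒′ ψ ⟧
    ∁∪-≐-⇒ a? = (λ { (inj₁ x∉a) x⊨φ → contradiction (proj₂ a≐φ x⊨φ) x∉a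
                   ; (inj₂ x∈b) _ → proj₁ b≐ψ x∈b })
              , λ {x} → byCases x
      where
      byCases : ∀ x → (x ⊨ φ → x ⊨ ψ) → (∁ a ∪ b) x
      byCases x φ→ψ with a? x
      ... | yes x∈a = inj₂ (proj₂ b≐ψ (φ→ψ (proj₁ a≐φ x∈a)))
      ... | no x∉a = inj₁ x∉a

  □-≐-□ : {a : Subset X} (φ : Fm Prop) → a ≐ ⟦ φ ⟧ → (λ x → ∀ y → R x y → a y) ≐ ⟦ □′ φ ⟧
  □-≐-□ φ a≐φ = (λ h y xRy → proj₁ a≐φ (h y xRy)) , (λ h y xRy → proj₂ a≐φ (h y xRy))

  unsatisfiable⇒refuted : ExcludedMiddle 0ℓ → ∀ {Γ K} → ¬ Satisfiable M Γ K →
    ∀ {y} → K y → Σ (Fm Prop) λ φ → Γ φ × ¬ y ⊨ φ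
  unsatisfiable⇒refuted em unsat {y} y∈K = decidable-stable em λ none →
    unsat (y , y∈K , λ φ φ∈Γ → decidable-stable em λ y⊭φ → none (φ , φ∈Γ , y⊭φ))

  module _ (em : ExcludedMiddle 0ℓ) {A : Subset X → Set} (adm : IsAdmissible M A) where
    open IsAdmissible adm

    truthSet-admissible : ∀ φ → Σ (Subset X) λ a → A a × a ≐ ⟦ φ ⟧
    truthSet-admissible ⊤′ = _ , has-X , (λ _ → tt) , (λ _ → tt)
    truthSet-admissible ⊥′ = _ , has-∅ , (λ ()) , (λ ())
    truthSet-admissible (var p) = _ , has-V p , (λ v → v) , (λ v → v)
    truthSet-admissible (φ ∧′ ψ) with truthSet-admissible φ | truthSet-admissible ψ
    ... | a , Aa , a≐φ | b , Ab , b≐ψ = _ , has-∩ a b Aa Ab , ∩-≐-∧ φ ψ a≐φ b≐ψ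
    truthSet-admissible (φ ∨′ ψ) with truthSet-admissible φ | truthSet-admissible ψ
    ... | a , Aa , a≐φ | b , Ab , b≐ψ = _ , has-∪ a b Aa Ab , ∪-≐-∨ φ ψ a≐φ b≐ψ
    truthSet-admissible (φ ⇒′ ψ) with truthSet-admissible φ | truthSet-admissible ψ
    ... | a , Aa , a≐φ | b , Ab , b≐ψ = _ , has-⇒ a b Aa Ab , ∁∪-≐-⇒ φ ψ a≐φ b≐ψ (λ _ → em)
    truthSet-admissible (□′ φ) with truthSet-admissible φ
    ... | a , Aa , a≐φ = _ , has-□ a Aa , □-≐-□ φ a≐φ

    ∁-truthSet-open : ∀ φ → IsOpen M A (∁ ⟦ φ ⟧)
    ∁-truthSet-open φ x x⊭φ with truthSet-admissible φ
    ... | a , Aa , a⊆φ , φ⊆a =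
      (a , Aa , false) ∷ [] , (x⊭φ ∘ a⊆φ) ∷ [] , λ { z (z∉a ∷ []) → z∉a ∘ φ⊆a }

    compact⇒saturated : {K : Subset X} → IsCompact M A K →
      ∀ Γ → FinitelySatisfiable M Γ K → Satisfiable M Γ K
    compact⇒saturated {K} compact Γ finSat = decidable-stable em unsatisfiable⇒⊥
      where
      Index : Set₁
      Index = Lift (lsuc 0ℓ) (Σ (Fm Prop) Γ)

      formula : Index → Fm Prop
      formula = proj₁ ∘ lower

      refutedBy : Index → Subset X
      refutedBy = ∁ ∘ ⟦_⟧ ∘ formula

      refutedBy-cover : ¬ Satisfiable M Γ K → ∀ y → K y → Σ Index λ i → refutedBy i y
      refutedBy-cover unsat y y∈K =
        let φ , φ∈Γ , y⊭φ = unsatisfiable⇒refuted em unsat y∈K in lift (φ , φ∈Γ) , y⊭φ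

      unsatisfiable⇒⊥ : ¬ Satisfiable M Γ K → ⊥
      unsatisfiable⇒⊥ unsat
        with compact Index refutedBy (∁-truthSet-open ∘ formula) (refutedBy-cover unsat)
      ... | is , subcover
        with finSat (map formula is) (All.map⁺ (All.universal (proj₂ ∘ lower) is))
      ... | y , y∈K , y⊨is = Any¬⇒¬All (Any.map⁺ (subcover y y∈K)) y⊨is

  image-compact⇒m-saturated : ExcludedMiddle 0ℓ → ImageCompact M → MSaturated M
  image-compact⇒m-saturated em (A , adm , compact) x = compact⇒saturated em adm (compact x)

  definable-admissible : ExcludedMiddle 0ℓ → IsAdmissible M Definable
  definable-admissible em = record
    { has-∅ = ⊥′ , (λ ()) , (λ ())
    ; has-X = ⊤′ , (λ _ → tt) , (λ _ → tt)
    ; has-V = λ p → var p , (λ v → v) , (λ v → v)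
    ; has-∪ = λ { _ _ (φ , a≐φ) (ψ , b≐ψ) → φ ∨′ ψ , ∪-≐-∨ φ ψ a≐φ b≐ψ }
    ; has-∩ = λ { _ _ (φ , a≐φ) (ψ , b≐ψ) → φ ∧′ ψ , ∩-≐-∧ φ ψ a≐φ b≐ψ }
    ; has-⇒ = λ { _ _ (φ , a≐φ) (ψ , b≐ψ) → φ ⇒′ ψ , ∁∪-≐-⇒ φ ψ a≐φ b≐ψ (λ _ → em) }
    ; has-□ = λ { _ (φ , a≐φ) → □′ φ , □-≐-□ φ a≐φ }
    }

  subbasicFormula : SubbaseElt M Definable → Fm Prop
  subbasicFormula (_ , (φ , _) , true) = φ
  subbasicFormula (_ , (φ , _) , false) = φ ⇒′ ⊥′

  subbasic-≐ : ∀ s → ⟦_⟧ₛ M s ≐ ⟦ subbasicFormula s ⟧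
  subbasic-≐ (_ , (φ , a≐φ) , true) = a≐φ
  subbasic-≐ (_ , (φ , a⊆φ , φ⊆a) , false) = (λ x∉a → x∉a ∘ φ⊆a) , (λ x⊭φ → x⊭φ ∘ a⊆φ)

  basicFormula : List (SubbaseElt M Definable) → Fm Prop
  basicFormula = foldr _∧′_ ⊤′ ∘ map subbasicFormula

  basic-≐ : ∀ ss → (λ x → All (λ s → ⟦_⟧ₛ M s x) ss) ≐ ⟦ basicFormula ss ⟧
  basic-≐ [] = (λ _ → tt) , (λ _ → [])
  basic-≐ (s ∷ ss) =
    (λ { (p ∷ ps) → proj₁ (subbasic-≐ s) p , proj₁ (basic-≐ ss) ps })
    , (λ { (p , ps) → proj₂ (subbasic-≐ s) p ∷ proj₂ (basic-≐ ss) ps })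

  definableNeighbourhood : {O : Subset X} → IsOpen M Definable O →
    ∀ {x} → O x → Σ (Fm Prop) λ φ → x ⊨ φ × ⟦ φ ⟧ ⊆ O
  definableNeighbourhood {O} open-O {x} x∈O with open-O x x∈O
  ... | ss , x∈ss , ss⊆O =
    basicFormula ss , proj₁ (basic-≐ ss) x∈ss , λ {z} z⊨ss → ss⊆O z (proj₂ (basic-≐ ss) z⊨ss)

  saturated⇒compact : ExcludedMiddle (lsuc 0ℓ) → {K : Subset X} →
    (∀ Γ → FinitelySatisfiable M Γ K → Satisfiable M Γ K) → IsCompact M Definable K
  saturated⇒compact em {K} saturated I U open-U cover = decidable-stable em noFiniteSubcover⇒⊥
    where
    em₀ : ExcludedMiddle 0ℓ
    em₀ = lowerEM (lsuc 0ℓ) em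

    FiniteSubcover : Set₁
    FiniteSubcover = Σ (List I) λ is → ∀ y → K y → Any (λ i → U i y) is

    RefutedInsideCover : Fm Prop → Set₁
    RefutedInsideCover χ = Σ I λ i → ∁ ⟦ χ ⟧ ⊆ U i

    -- RefutedInsideCover lives in Set₁, so Γ records its decision to stay in Set.
    Γ : Fm Prop → Set
    Γ χ = True (em {RefutedInsideCover χ})

    witness : ∀ {χ} → Γ χ → RefutedInsideCover χ
    witness {χ} = toWitness {a? = em {RefutedInsideCover χ}}

    indices : ∀ {fs} → All Γ fs → List I
    indices = All.reduce λ {χ} → proj₁ ∘ witness {χ}

    refutation-covered : ∀ {y} fs (χs∈Γ : All Γ fs) → Any (λ χ → ¬ y ⊨ χ) fs →
      Any (λ i → U i y) (indices χs∈Γ)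
    refutation-covered (χ ∷ _) (χ∈Γ ∷ _) (here y⊭χ) = here (proj₂ (witness {χ} χ∈Γ) y⊭χ)
    refutation-covered (_ ∷ fs) (_ ∷ χs∈Γ) (there p) = there (refutation-covered fs χs∈Γ p)

    finitelySatisfiable : ¬ FiniteSubcover →
      FinitelySatisfiable M Γ K
    finitelySatisfiable noFiniteSubcover fs χs∈Γ = decidable-stable em₀ λ noPoint →
      noFiniteSubcover (indices χs∈Γ , λ y y∈K →
        refutation-covered fs χs∈Γ (¬All⇒Any¬ (λ _ → em₀) fs λ y⊨fs → noPoint (y , y∈K , y⊨fs)))

    noFiniteSubcover⇒⊥ : ¬ FiniteSubcover → ⊥
    noFiniteSubcover⇒⊥ noFiniteSubcover
      with saturated Γ (finitelySatisfiable noFiniteSubcover)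
    ... | y , y∈K , y⊨Γ with cover y y∈K
    ... | i , y∈Uᵢ with definableNeighbourhood (open-U i) y∈Uᵢ
    ... | φ , y⊨φ , φ⊆Uᵢ =
      y⊨Γ (φ ⇒′ ⊥′) (fromWitness (i , λ {_} z⊭¬φ → φ⊆Uᵢ (decidable-stable em₀ z⊭¬φ))) y⊨φ

  m-saturated⇒image-compact : ExcludedMiddle (lsuc 0ℓ) → MSaturated M → ImageCompact M
  m-saturated⇒image-compact em saturated =
    Definable , definable-admissible (lowerEM (lsuc 0ℓ) em) , λ x → saturated⇒compact em (saturated x)

proposition7p2 : ExcludedMiddle (Level.suc (Level.suc Level.zero)) →
    {Prop : Set} (M : Kripke Prop) → ImageCompact M ⇔ MSaturated M
proposition7p2 em M =
  mk⇔ (image-compact⇒m-saturated M (lowerEM _ em)) (m-saturated⇒image-compact M (lowerEM _ em))
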